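{- Let $G=(V,E,w)$ be a restricted graph and let $S\subseteq V$ be such that $S$ has weak diameter $d$ in $G_{\geq 0}$. Then for every $v\in S$, any shortest $S$-$v$-path $P$ in the induced subgraph $G[S]$ has at most $d$ edges and satisfies $w_{\geq 0}(P)\le d$.
   Context: A directed graph $G=(V,E,w)$ with integer weights on $n$ vertices is restricted if (i) $w(e)\in\{ -1,0,1,\dots,n\}$ for all $e\in E$, and (ii) every directed cycle $C$ satisfies $\sum_{e\in C}w(e)\ge |C|$, where $|C|$ is the number of edges. $G_{\geq 0}=(V,E,w_{\geq 0})$ with $w_{\geq 0}(e)=\max(0,w(e))$. A set $S\subseteq V$ has weak diameter $d$ in a graph $H$ if $\mathrm{dist}_H(u,v)\le d$ and $\mathrm{dist}_H(v,u)\le d$ for all $u,v\in S$. A shortest $S$-$v$-path in $G[S]$ is a path in $G[S]$ of minimum weight among all paths in $G[S]$ starting at some vertex of $S$ and ending at $v$. For a path $P$, $w(P)$ and $w_{\ge0}(P)$ denote the sum of the respective weights over its edges. -}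

module Defs where

open import Data.Nat using (ℕ; suc)
open import Data.Fin using (Fin)
open import Data.Bool using (Bool; true; false; _∧_; if_then_else_)
open import Data.Integer using (ℤ; +_; -[1+_]; _+_; _⊔_; _≤_)
open import Data.Maybe using (Maybe; just; nothing; map)
open import Data.List using (List; []; _∷_)
open import Data.List.Relation.Unary.Unique.Propositional using (Unique)
open import Data.Product using (Σ; ∃; _×_; _,_)
open import Data.Empty using (⊥)
open import Relation.Binary.PropositionalEquality using (_≡_)

-- A weighted directed graph on vertex set Fin n:
-- G u v ≡ just c  means there is an edge u → v of weight c; nothing = no edge.
Graph : ℕ → Set
Graph n = Fin n → Fin n → Maybe ℤ

VSet : ℕ → Set
VSet n = Fin n → Bool

_∈S_ : ∀ {n} → Fin n → VSet n → Set
u ∈S S = S u ≡ true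

data Walk {n : ℕ} (G : Graph n) : Fin n → Fin n → Set where
  []   : ∀ {u} → Walk G u u
  step : ∀ {u} (v : Fin n) {x} (c : ℤ) → G u v ≡ just c → Walk G v x → Walk G u x

module _ {n : ℕ} {G : Graph n} where
  len : ∀ {u x} → Walk G u x → ℕ
  len []               = 0
  len (step _ _ _ p)   = suc (len p)

  wt : ∀ {u x} → Walk G u x → ℤ
  wt []              = + 0
  wt (step _ c _ p)  = c + wt p

  wt≥0 : ∀ {u x} → Walk G u x → ℤ
  wt≥0 []             = + 0
  wt≥0 (step _ c _ p) = (c ⊔ + 0) + wt≥0 p

  -- the vertices of a walk, listed at the tail of each edge
  -- (for a closed walk: the vertices of the cycle, each once per visit)
  tails : ∀ {u x} → Walk G u x → List (Fin n)
  tails []                     = []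
  tails (step {u = u} _ _ _ p) = u ∷ tails p

IsCycle : ∀ {n} {G : Graph n} {u : Fin n} → Walk G u u → Set
IsCycle []                  = ⊥
IsCycle p@(step _ _ _ _)    = Unique (tails p)

Restricted : ∀ {n} → Graph n → Set
Restricted {n} G =
  (∀ u v c → G u v ≡ just c → (-[1+ 0 ] ≤ c) × (c ≤ + n)) ×
  (∀ u (C : Walk G u u) → IsCycle C → + len C ≤ wt C)

G≥0 : ∀ {n} → Graph n → Graph n
G≥0 G u v = map (λ c → c ⊔ + 0) (G u v)

-- dist_H(u,v) ≤ d   (dist = ∞ if no walk exists)
DistLe : ∀ {n} → Graph n → Fin n → Fin n → ℤ → Set
DistLe H u v d = Σ (Walk H u v) (λ P → wt P ≤ d)

WeakDiam : ∀ {n} → Graph n → VSet n → ℤ → Set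
WeakDiam H S d = ∀ u v → u ∈S S → v ∈S S → DistLe H u v d × DistLe H v u d

induced : ∀ {n} → Graph n → VSet n → Graph n
induced G S u v = if S u ∧ S v then G u v else nothing

ShortestSPath : ∀ {n} (G : Graph n) (S : VSet n) {s v : Fin n} → Walk (induced G S) s v → Set
ShortestSPath {n} G S {s} {v} P =
  s ∈S S × (∀ (s' : Fin n) → s' ∈S S → (Q : Walk (induced G S) s' v) → wt P ≤ wt Q)

-- The excess w(e) − 1 of an edge is additive along walks and, by condition (ii), nonnegative on
-- every cycle; cutting cycles out of a closed walk one at a time therefore shows
-- that every closed walk C of a restricted graph has |C| ≤ w(C). Close the shortest
-- S-v-path P (weight ≤ 0, as the empty path at v competes) by a v-s-walk Q of
-- weight ≤ d, obtained from the weak diameter: |P| + |Q| ≤ w(P) + w(Q) ≤ d. Since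
-- all weights are ≥ −1, also w_{≥0}(P) ≤ w(P) + |P| ≤ 2 w(P) + w(Q) ≤ d.
module Submission where

open import Defs
open import Data.Nat using (ℕ)
open import Data.Fin using (Fin)
open import Data.Integer using (+_)
open import Data.Product using (_×_)
import Data.Nat as N
import Data.Integer as Z

open import Algebra.Properties.CommutativeSemigroup using (interchange)
open import Data.Bool using (true; false; _∧_)
open import Data.Empty using (⊥-elim)
open import Data.Integer using (ℤ; 0ℤ; 1ℤ; -1ℤ; _+_; _-_; -_; _⊔_; _≤_)
open import Data.Integer.Properties
  using ( ≤-refl; ≤-trans; +-mono-≤; +-monoˡ-≤; +-monoʳ-≤; +-assoc; +-identityˡ
        ; ⊔-lub; i≤i⊔j; i≤i+j; neg-distrib-+; i≤j⇒0≤j-i; 0≤i-j⇒j≤i; drop‿+≤+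
        ; +-commutativeSemigroup; module ≤-Reasoning )
import Data.Fin.Properties as Fin
import Data.Product as Product
open import Data.List using (List; []; _∷_; _++_)
open import Data.List.Membership.Propositional using (_∈_)
open import Data.List.Relation.Unary.All as All using (All; []; _∷_)
open import Data.List.Relation.Unary.All.Properties using (¬Any⇒All¬; ++⁻ˡ)
open import Data.List.Relation.Unary.AllPairs using ([]; _∷_)
open import Data.List.Relation.Unary.Any using (here; there)
open import Data.List.Relation.Unary.Unique.Propositional using (Unique)
open import Data.Maybe using (just)
open import Data.Product using (Σ; ∃₂; _,_; proj₁; proj₂)
open import Relation.Binary.PropositionalEquality
  using (_≡_; _≢_; refl; sym; trans; cong; subst; ≢-sym; module ≡-Reasoning)
open import Relation.Nullary using (yes; no)

EdgeWeights≥-1 : ∀ {n} → Graph n → Set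
EdgeWeights≥-1 G = ∀ {u v c} → G u v ≡ just c → -1ℤ ≤ c

CycleWeight≥Length : ∀ {n} → Graph n → Set
CycleWeight≥Length G = ∀ u (C : Walk G u u) → IsCycle C → + len C ≤ wt C

module _ {n : ℕ} {G : Graph n} where

  open import Data.List.Membership.DecPropositional (Fin._≟_ {n}) using (_∈?_)

  infixr 5 _++ʷ_

  _++ʷ_ : ∀ {u v x} → Walk G u v → Walk G v x → Walk G u x
  []           ++ʷ q = q
  step v c e p ++ʷ q = step v c e (p ++ʷ q)

  len-++ : ∀ {u v x} (p : Walk G u v) (q : Walk G v x) → len (p ++ʷ q) ≡ len p N.+ len q
  len-++ []             q = refl
  len-++ (step _ _ _ p) q = cong N.suc (len-++ p q)

  wt-++ : ∀ {u v x} (p : Walk G u v) (q : Walk G v x) → wt (p ++ʷ q) ≡ wt p + wt q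
  wt-++ []             q = sym (+-identityˡ (wt q))
  wt-++ (step _ c _ p) q = trans (cong (_+_ c) (wt-++ p q)) (sym (+-assoc c (wt p) (wt q)))

  verts : ∀ {u x} → Walk G u x → List (Fin n)
  verts {u} []             = u ∷ []
  verts {u} (step _ _ _ p) = u ∷ verts p

  verts-++ : ∀ {u v x} (p : Walk G u v) (q : Walk G v x) → verts (p ++ʷ q) ≡ tails p ++ verts q
  verts-++ []             q = refl
  verts-++ (step _ _ _ p) q = cong (_ ∷_) (verts-++ p q)

  end∈verts : ∀ {u x} (p : Walk G u x) → x ∈ verts p
  end∈verts []             = here refl
  end∈verts (step _ _ _ p) = there (end∈verts p)

  IsPath : ∀ {u x} → Walk G u x → Set
  IsPath p = Unique (verts p)

  closedPath≡[] : ∀ {u} (C : Walk G u u) → IsPath C → C ≡ []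
  closedPath≡[] []             _         = refl
  closedPath≡[] (step _ _ _ p) (u∉p ∷ _) = ⊥-elim (All.lookup u∉p (end∈verts p) refl)

  split-path : ∀ {u v x} (W : Walk G v x) → IsPath W → u ∈ verts W →
    ∃₂ λ (A : Walk G v u) (B : Walk G u x) → W ≡ A ++ʷ B × Unique (u ∷ tails A) × IsPath B
  split-path []               _    (here refl) = [] , [] , refl , [] ∷ [] , [] ∷ []
  split-path W@(step _ _ _ _) path (here refl) = [] , W , refl , [] ∷ [] , path
  split-path {v = v} (step w c e W) (v∉W ∷ pathW) (there u∈W) with split-path W pathW u∈W
  ... | A , B , refl , u∉A ∷ pathA , pathB =
    step w c e A , B , refl , (≢-sym (All.lookup v∉W u∈W) ∷ u∉A) ∷ (v∉A ∷ pathA) , pathB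
    where
    v∉A : All (v ≢_) (tails A)
    v∉A = ++⁻ˡ (tails A) (subst (All (v ≢_)) (verts-++ A B) v∉W)

  excess : ∀ {u x} → Walk G u x → ℤ
  excess []             = 0ℤ
  excess (step _ c _ p) = (c - 1ℤ) + excess p

  excess-++ : ∀ {u v x} (p : Walk G u v) (q : Walk G v x) →
    excess (p ++ʷ q) ≡ excess p + excess q
  excess-++ []             q = sym (+-identityˡ (excess q))
  excess-++ (step _ c _ p) q =
    trans (cong (_+_ (c - 1ℤ)) (excess-++ p q)) (sym (+-assoc (c - 1ℤ) (excess p) (excess q)))

  excess≡wt-len : ∀ {u x} (p : Walk G u x) → excess p ≡ wt p - + len p
  excess≡wt-len []             = refl
  excess≡wt-len (step _ c _ p) = begin
    (c - 1ℤ) + excess p          ≡⟨ cong (_+_ (c - 1ℤ)) (excess≡wt-len p) ⟩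
    (c - 1ℤ) + (wt p - + len p)  ≡⟨ interchange +-commutativeSemigroup c (- 1ℤ) (wt p) (- + len p) ⟩
    (c + wt p) + (- 1ℤ - + len p) ≡⟨ cong (_+_ (c + wt p)) (neg-distrib-+ 1ℤ (+ len p)) ⟨
    (c + wt p) - (1ℤ + + len p)  ∎
    where open ≡-Reasoning

  cycle-excess≥0 : CycleWeight≥Length G → ∀ {u} (C : Walk G u u) → IsCycle C → 0ℤ ≤ excess C
  cycle-excess≥0 cycles C isCycle =
    subst (0ℤ ≤_) (sym (excess≡wt-len C)) (i≤j⇒0≤j-i (cycles _ C isCycle))

  shortcut : CycleWeight≥Length G → ∀ {u x} (W : Walk G u x) →
    Σ (Walk G u x) λ W′ → IsPath W′ × excess W′ ≤ excess W
  shortcut cycles [] = [] , [] ∷ [] , ≤-refl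
  shortcut cycles {u} (step v c e W) with shortcut cycles W
  ... | W′ , pathW′ , W′≤W with u ∈? verts W′
  ... | no u∉W′ = step v c e W′ , ¬Any⇒All¬ _ u∉W′ ∷ pathW′ , +-monoʳ-≤ (c - 1ℤ) W′≤W
  ... | yes u∈W′ with split-path W′ pathW′ u∈W′
  ... | A , B , refl , cycle , pathB = B , pathB , (begin
    excess B                               ≡⟨ +-identityˡ (excess B) ⟨
    0ℤ + excess B                          ≤⟨ +-monoˡ-≤ (excess B) (cycle-excess≥0 cycles (step v c e A) cycle) ⟩
    excess (step v c e A) + excess B       ≡⟨ +-assoc (c - 1ℤ) (excess A) (excess B) ⟩
    (c - 1ℤ) + (excess A + excess B)       ≡⟨ cong (_+_ (c - 1ℤ)) (excess-++ A B) ⟨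
    excess (step v c e (A ++ʷ B))          ≤⟨ +-monoʳ-≤ (c - 1ℤ) W′≤W ⟩
    excess (step v c e W)                  ∎)
    where open ≤-Reasoning

  closedWalk-len≤wt : CycleWeight≥Length G → ∀ {u} (C : Walk G u u) → + len C ≤ wt C
  closedWalk-len≤wt cycles C with shortcut cycles C
  ... | C′ , pathC′ , C′≤C =
    0≤i-j⇒j≤i (subst (0ℤ ≤_) (excess≡wt-len C)
      (subst (λ W → excess W ≤ excess C) (closedPath≡[] C′ pathC′) C′≤C))

  wt≤wt≥0 : ∀ {u x} (p : Walk G u x) → wt p ≤ wt≥0 p
  wt≤wt≥0 []             = ≤-refl
  wt≤wt≥0 (step _ c _ p) = +-mono-≤ (i≤i⊔j c 0ℤ) (wt≤wt≥0 p)

  wt≥0≤wt+len : EdgeWeights≥-1 G → ∀ {u x} (p : Walk G u x) → wt≥0 p ≤ wt p + + len p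
  wt≥0≤wt+len w≥-1 []             = ≤-refl
  wt≥0≤wt+len w≥-1 (step _ c e p) = begin
    (c ⊔ 0ℤ) + wt≥0 p             ≤⟨ +-mono-≤ clamp≤c+1 (wt≥0≤wt+len w≥-1 p) ⟩
    (c + 1ℤ) + (wt p + + len p)   ≡⟨ interchange +-commutativeSemigroup c 1ℤ (wt p) (+ len p) ⟩
    (c + wt p) + (1ℤ + + len p)   ∎
    where
    open ≤-Reasoning
    clamp≤c+1 : c ⊔ 0ℤ ≤ c + 1ℤ
    clamp≤c+1 = ⊔-lub (i≤i+j c 1ℤ) (+-monoˡ-≤ 1ℤ (w≥-1 e))

  bounds-via-return-walk : EdgeWeights≥-1 G → CycleWeight≥Length G → ∀ {s v} {d : ℕ}
    (P : Walk G s v) (Q : Walk G v s) → wt P ≤ 0ℤ → wt Q ≤ + d →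
    (len P N.≤ d) × (wt≥0 P ≤ + d)
  bounds-via-return-walk w≥-1 cycles {d = d} P Q P≤0 Q≤d =
    drop‿+≤+ (≤-trans len≤wtPQ wtPQ≤d) , (begin
      wt≥0 P                 ≤⟨ wt≥0≤wt+len w≥-1 P ⟩
      wt P + + len P         ≤⟨ +-monoʳ-≤ (wt P) len≤wtPQ ⟩
      wt P + (wt P + wt Q)   ≤⟨ +-mono-≤ P≤0 wtPQ≤d ⟩
      + d                    ∎)
    where
    open ≤-Reasoning
    wtPQ≤d : wt P + wt Q ≤ + d
    wtPQ≤d = +-mono-≤ P≤0 Q≤d
    len≤wtPQ : + len P ≤ wt P + wt Q
    len≤wtPQ = begin
      + len P                  ≤⟨ i≤i+j (+ len P) (+ len Q) ⟩
      + (len P N.+ len Q)      ≡⟨ cong +_ (len-++ P Q) ⟨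
      + len (P ++ʷ Q)          ≤⟨ closedWalk-len≤wt cycles (P ++ʷ Q) ⟩
      wt (P ++ʷ Q)             ≡⟨ wt-++ P Q ⟩
      wt P + wt Q              ∎

module _ {n : ℕ} (G : Graph n) where

  unclamp : ∀ {u x} (W : Walk (G≥0 G) u x) → Σ (Walk G u x) λ W′ → wt≥0 W′ ≡ wt W
  unclamp []                 = [] , refl
  unclamp (step {u} v c e W) with G u v in edge | e | unclamp W
  ... | just c′ | refl | W′ , W′≡W = step v c′ edge W′ , cong (_+_ (c′ ⊔ 0ℤ)) W′≡W

DistLe-≥0⇒DistLe : ∀ {n} {G : Graph n} {u x d} → DistLe (G≥0 G) u x d → DistLe G u x d
DistLe-≥0⇒DistLe {G = G} {d = d} (W , W≤d) with unclamp G W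
... | W′ , W′≡W = W′ , ≤-trans (wt≤wt≥0 W′) (subst (_≤ d) (sym W′≡W) W≤d)

_⊆ᴳ_ : ∀ {n} → Graph n → Graph n → Set
H ⊆ᴳ G = ∀ {u v c} → H u v ≡ just c → G u v ≡ just c

induced-⊆ᴳ : ∀ {n} (G : Graph n) (S : VSet n) → induced G S ⊆ᴳ G
induced-⊆ᴳ G S {u} {v} with S u ∧ S v
... | true  = λ e → e
... | false = λ ()

module _ {n : ℕ} {H G : Graph n} (H⊆G : H ⊆ᴳ G) where

  embed : ∀ {u x} → Walk H u x → Walk G u x
  embed []             = []
  embed (step v c e p) = step v c (H⊆G e) (embed p)

  len-embed : ∀ {u x} (p : Walk H u x) → len (embed p) ≡ len p
  len-embed []             = refl
  len-embed (step _ _ _ p) = cong N.suc (len-embed p)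

  wt-embed : ∀ {u x} (p : Walk H u x) → wt (embed p) ≡ wt p
  wt-embed []             = refl
  wt-embed (step _ c _ p) = cong (_+_ c) (wt-embed p)

  wt≥0-embed : ∀ {u x} (p : Walk H u x) → wt≥0 (embed p) ≡ wt≥0 p
  wt≥0-embed []             = refl
  wt≥0-embed (step _ c _ p) = cong (_+_ (c ⊔ 0ℤ)) (wt≥0-embed p)

lemma3p2 : ∀ (n : ℕ) (G : Graph n) (S : VSet n) (d : ℕ) →
    Restricted G → WeakDiam (G≥0 G) S (+ d) →
    ∀ (v : Fin n) → v ∈S S → ∀ (s : Fin n) (P : Walk (induced G S) s v) →
    ShortestSPath G S P →
    (len P N.≤ d) × (wt≥0 P Z.≤ + d)
lemma3p2 n G S d restricted diam v v∈S s P (s∈S , shortest)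
  with DistLe-≥0⇒DistLe (proj₂ (diam s v s∈S v∈S))
... | Q , Q≤d =
  Product.map (subst (N._≤ d) (len-embed G[S]⊆G P)) (subst (_≤ + d) (wt≥0-embed G[S]⊆G P))
    (bounds-via-return-walk w≥-1 (proj₂ restricted) (embed G[S]⊆G P) Q P≤0 Q≤d)
  where
  G[S]⊆G : induced G S ⊆ᴳ G
  G[S]⊆G = induced-⊆ᴳ G S
  w≥-1 : EdgeWeights≥-1 G
  w≥-1 e = proj₁ (proj₁ restricted _ _ _ e)
  P≤0 : wt (embed G[S]⊆G P) ≤ 0ℤ
  P≤0 = subst (_≤ 0ℤ) (sym (wt-embed G[S]⊆G P)) (shortest v v∈S [])
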